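{- Fix an integer $M\ge 1$. Let $D_1,\dots,D_M\in\widetilde{\mathbf{S}}_2$ be Boolean truth value assessments over the variables $A_1,\dots,A_M$ (as described in the context), and implement $\vee$ by $\max$, $\wedge$ by $\min$ and ${}^{\prime}$ by the standard negation $u\mapsto 1-u$. Let $f_m(x)=\mathrm{Tr}_x(D_m)$ for $x\in[0,1]^M$. Then $(1/2,1/2,\dots,1/2)\in[0,1]^M$ is a solution of the truth value equations $x_m=f_m(x_1,\dots,x_M)$, $m=1,\dots,M$.
   Context: Let $\mathbf{V}_1=\{A_1,\dots,A_M\}$ be a set of formal symbols. $\mathbf{S}_1$ is the smallest set of formal expressions containing $\mathbf{V}_1$ and such that if $B_1,B_2\in\mathbf{S}_1$ then $B_1\vee B_2$, $B_1\wedge B_2$, $B_1^{\prime}\in\mathbf{S}_1$. $\widetilde{\mathbf{V}}_2$ is the set of formal expressions ``$\mathrm{Tr}(B)=b$'' with $B\in\mathbf{S}_1$ and $b\in\{0,1\}$ (Boolean elementary truth value assessments), and $\widetilde{\mathbf{S}}_2$ is the smallest set of formal expressions containing $\widetilde{\mathbf{V}}_2$ and closed under $D_1\vee D_2$, $D_1\wedge D_2$, $D_1^{\prime}$. For $x=(x_1,\dots,x_M)\in[0,1]^M$, truth values are defined recursively with the given implementations: $\mathrm{Tr}_x(A_m)=x_m$; $\mathrm{Tr}_x(B_1\vee B_2)=\max(\mathrm{Tr}_x(B_1),\mathrm{Tr}_x(B_2))$, $\mathrm{Tr}_x(B_1\wedge B_2)=\min(\mathrm{Tr}_x(B_1),\mathrm{Tr}_x(B_2))$,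 $\mathrm{Tr}_x(B^{\prime})=1-\mathrm{Tr}_x(B)$ on $\mathbf{S}_1$; for $C=$``$\mathrm{Tr}(B)=b$'', $\mathrm{Tr}_x(C)=1-|\mathrm{Tr}_x(B)-b|$; and the same recursive rules (max, min, $1-u$) extend $\mathrm{Tr}_x$ to all of $\widetilde{\mathbf{S}}_2$. -}

module Defs where

open import Data.Nat using (ℕ)
open import Data.Fin using (Fin)
open import Data.Bool using (Bool; true; false)
open import Data.Rational using (ℚ; 0ℚ; 1ℚ; _-_; _⊔_; _⊓_; ∣_∣)

data S₁ (M : ℕ) : Set where
  A    : Fin M → S₁ M
  _∨₁_ : S₁ M → S₁ M → S₁ M
  _∧₁_ : S₁ M → S₁ M → S₁ M
  _′₁  : S₁ M → S₁ M

data S₂ (M : ℕ) : Set where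
  Tr[_]≐_ : S₁ M → Bool → S₂ M
  _∨₂_    : S₂ M → S₂ M → S₂ M
  _∧₂_    : S₂ M → S₂ M → S₂ M
  _′₂     : S₂ M → S₂ M

⟦_⟧𝔹 : Bool → ℚ
⟦ false ⟧𝔹 = 0ℚ
⟦ true  ⟧𝔹 = 1ℚ

Tr₁ : {M : ℕ} → (Fin M → ℚ) → S₁ M → ℚ
Tr₁ x (A m)      = x m
Tr₁ x (B ∨₁ C)   = Tr₁ x B ⊔ Tr₁ x C
Tr₁ x (B ∧₁ C)   = Tr₁ x B ⊓ Tr₁ x C
Tr₁ x (B ′₁)     = 1ℚ - Tr₁ x B

Tr₂ : {M : ℕ} → (Fin M → ℚ) → S₂ M → ℚ
Tr₂ x (Tr[ B ]≐ b) = 1ℚ - ∣ Tr₁ x B - ⟦ b ⟧𝔹 ∣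
Tr₂ x (D ∨₂ E)     = Tr₂ x D ⊔ Tr₂ x E
Tr₂ x (D ∧₂ E)     = Tr₂ x D ⊓ Tr₂ x E
Tr₂ x (D ′₂)       = 1ℚ - Tr₂ x D

{-# OPTIONS --safe #-}
module Submission where

-- ½ is a fixed point of max, min and u ↦ 1 - u, and 1 - |½ - b| = ½ for b ∈ {0,1};
-- hence every formula of S₁ and S̃₂ evaluates to ½ at the centre of the cube.

open import Defs
open import Data.Nat using (ℕ; _≥_)
open import Data.Fin using (Fin)
open import Data.Bool using (Bool; true; false)
open import Data.Rational using (ℚ; ½; 1ℚ; _-_; _⊔_; _⊓_; ∣_∣)
open import Data.Rational.Properties using (⊔-idem; ⊓-idem)
open import Relation.Binary.PropositionalEquality using (_≡_; refl; sym; trans; cong; cong₂)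

centre : {M : ℕ} → Fin M → ℚ
centre _ = ½

1-½≡½ : 1ℚ - ½ ≡ ½
1-½≡½ = refl

1-∣½-b∣≡½ : (b : Bool) → 1ℚ - ∣ ½ - ⟦ b ⟧𝔹 ∣ ≡ ½
1-∣½-b∣≡½ false = refl
1-∣½-b∣≡½ true  = refl

Tr₁-centre : {M : ℕ} (B : S₁ M) → Tr₁ centre B ≡ ½
Tr₁-centre (A m)    = refl
Tr₁-centre (B ∨₁ C) = trans (cong₂ _⊔_ (Tr₁-centre B) (Tr₁-centre C)) (⊔-idem ½)
Tr₁-centre (B ∧₁ C) = trans (cong₂ _⊓_ (Tr₁-centre B) (Tr₁-centre C)) (⊓-idem ½)
Tr₁-centre (B ′₁)   = trans (cong (1ℚ -_) (Tr₁-centre B)) 1-½≡½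

Tr₂-centre : {M : ℕ} (D : S₂ M) → Tr₂ centre D ≡ ½
Tr₂-centre (Tr[ B ]≐ b) =
  trans (cong (λ u → 1ℚ - ∣ u - ⟦ b ⟧𝔹 ∣) (Tr₁-centre B)) (1-∣½-b∣≡½ b)
Tr₂-centre (D ∨₂ E) = trans (cong₂ _⊔_ (Tr₂-centre D) (Tr₂-centre E)) (⊔-idem ½)
Tr₂-centre (D ∧₂ E) = trans (cong₂ _⊓_ (Tr₂-centre D) (Tr₂-centre E)) (⊓-idem ½)
Tr₂-centre (D ′₂)   = trans (cong (1ℚ -_) (Tr₂-centre D)) 1-½≡½

proposition4 : (M : ℕ) → M ≥ 1 → (D : Fin M → S₂ M) →
    (m : Fin M) → ½ ≡ Tr₂ (λ _ → ½) (D m)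
proposition4 M _ D m = sym (Tr₂-centre (D m))
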